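{- Let $\langle A,\vee\rangle$ be a join-semilattice and $c\in A$ arbitrary. Consider the maps $\mathsf{I}:\langle\theta,\delta\rangle\mapsto\langle I_\theta,I_\delta\rangle$, where $I_\theta=\{a\in A: a\,\theta\,c\}$, and $\mathsf{K}:\langle I_1,I_2\rangle\mapsto\langle\ker\pi_2,\ker\pi_1\rangle$. Then $\mathsf{I}$ and $\mathsf{K}$ are well-defined, mutually inverse maps between the set of pairs $\langle\theta,\delta\rangle$ of complementary factor congruences of $A$ and the set of pairs $\langle I_1,I_2\rangle$ of subsemilattices of $A$ such that $A=I_1\oplus_c I_2$.
   Context: A join-semilattice $\langle A,\vee\rangle$ is a set with an idempotent, commutative, associative binary operation $\vee$; it is ordered by $a\le b$ iff $a\vee b=b$. The partial operation $a\wedge b$ denotes the infimum of $\{a,b\}$ when it exists. Convention: a formula "$x\wedge y=z$" means "the infimum of $\{x,y\}$ exists and equals $z$"; any equation $t_1=t_2$ involving $\wedge$ means "if either side exists, then the other also exists and they are equal". A subsemilattice is a subset closed under $\vee$. A pair $\langle\theta,\delta\rangle$ of complementary factor congruences of $A$ is a pair of congruences that are the kernels of the two canonical projections of some direct product decomposition $A\cong A_1\times A_2$; equivalently $a\mapsto\langle a/\delta,a/\theta\rangle$ is an isomorphism $A\to A/\delta\times A/\theta$. For fixed $c\in A$, $\phi_c(x_1,x_2,x)$ is the conjunction of: (dist) $x=(x\vee x_1)\wedge(x\vee x_2)$; (p1) $x_1=(x\vee x_1)\wedge(c\vee x_1)$; (p2) $x_2=(x\vee x_2)\wedge(c\vee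 x_2)$; (join) $x_1\vee x_2=x\vee c$. For subsemilattices $I_1,I_2$, $A=I_1\oplus_c I_2$ means all of the following hold: (Mod1) for all $x,y\in A$, $x_1\in I_1$, $x_2\in I_2$: if $x\vee c\ge x_1\vee x_2$ then $((x\vee x_1)\wedge(x\vee x_2))\vee y=(x\vee y\vee x_1)\wedge(x\vee y\vee x_2)$; (Mod2) for all $x,y\in A$, $x_1\in I_1$, $x_2\in I_2$: if $x\le x_1\vee x_2$ then $((x\vee x_i)\wedge(c\vee x_i))\vee y=(x\vee y\vee x_i)\wedge(c\vee y\vee x_i)$ for $i=1,2$; (Abs) for all $x_1,y_1\in I_1$, $z_2\in I_2$: $x_1\wedge(y_1\vee z_2)=x_1\wedge(y_1\vee c)$, and likewise with $I_1,I_2$ interchanged; (exi) for all $x_1\in I_1,x_2\in I_2$ there is $x\in A$ with $\phi_c(x_1,x_2,x)$; (onto) for all $x\in A$ there are $x_1\in I_1,x_2\in I_2$ with $\phi_c(x_1,x_2,x)$. When $A=I_1\oplus_c I_2$, for each $x\in A$ there are unique $x_1\in I_1$, $x_2\in I_2$ with $\phi_c(x_1,x_2,x)$ (and $\phi_c$ gives an isomorphism $I_1\times I_2\cong A$); the projections $\pi_j:A\to I_j$ ($j=1,2$) are defined by $\pi_1(x)=x_1$, $\pi_2(x)=x_2$, i.e. $\phi_c(x_1,x_2,x)\iff \pi_1(x)=x_1$ and $\pi_2(x)=x_2$. $\ker\pi_j=\{\langle a,b\rangle\in A^2:\pi_j(a)=\pi_j(b)\}$. -}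

module Defs where

open import Level using (0ℓ)
open import Algebra.Core using (Op₂)
import Algebra.Lattice.Structures as LS
open import Data.Product using (Σ; Σ-syntax; _×_; proj₁; proj₂)
open import Function.Bundles using (_⇔_)
open import Relation.Binary.PropositionalEquality using (_≡_)
open import Relation.Binary.Core using (Rel)
open import Relation.Binary.Structures using (IsEquivalence)
open import Relation.Unary using (Pred)

IsJoinSL : (A : Set) → Op₂ A → Set
IsJoinSL A _∨_ = LS.IsJoinSemilattice (_≡_ {A = A}) _∨_

module SL {A : Set} (_∨_ : Op₂ A) where

  infix 4 _≤_
  _≤_ : A → A → Set
  a ≤ b = a ∨ b ≡ b

  IsMeet : A → A → A → Set
  IsMeet a b m = (m ≤ a) × (m ≤ b) × (∀ w → w ≤ a → w ≤ b → w ≤ m)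

  -- Partial terms are represented by the predicate "the term exists and has value v".
  -- Equation t₁ = t₂ between partial terms: either side exists iff the other does,
  -- and then they are equal, i.e. they have the same values.
  _≃_ : Pred A 0ℓ → Pred A 0ℓ → Set
  P ≃ Q = ∀ v → P v ⇔ Q v

  meet : A → A → Pred A 0ℓ
  meet a b v = IsMeet a b v

  meet∨ : A → A → A → Pred A 0ℓ
  meet∨ a b y v = Σ[ m ∈ A ] (IsMeet a b m × (m ∨ y) ≡ v)

  IsSubSL : Pred A 0ℓ → Set
  IsSubSL I = ∀ {a b} → I a → I b → I (a ∨ b)

  record IsCongruence (θ : Rel A 0ℓ) : Set where
    field
      isEquivalence : IsEquivalence θ
      ∨-compat      : ∀ {a b a' b'} → θ a a' → θ b b' → θ (a ∨ b) (a' ∨ b')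

  -- ⟨θ, δ⟩ complementary factor congruences: θ, δ congruences and
  -- a ↦ ⟨a/δ, a/θ⟩ is a bijection A → A/δ × A/θ (it is automatically a homomorphism):
  -- injective: a δ b and a θ b imply a = b; surjective: for all a, b there is x with x δ a, x θ b.
  record IsComplFactorCong (θ δ : Rel A 0ℓ) : Set where
    field
      θ-cong : IsCongruence θ
      δ-cong : IsCongruence δ
      inj    : ∀ {a b} → δ a b → θ a b → a ≡ b
      surj   : ∀ a b → Σ[ x ∈ A ] (δ x a × θ x b)

  module _ (c : A) where

    φ : A → A → A → Set
    φ x₁ x₂ x =
        IsMeet (x ∨ x₁) (x ∨ x₂) x
      × IsMeet (x ∨ x₁) (c ∨ x₁) x₁
      × IsMeet (x ∨ x₂) (c ∨ x₂) x₂
      × (x₁ ∨ x₂ ≡ x ∨ c)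

    -- A = I₁ ⊕_c I₂   (x ∨ y ∨ z is read as (x ∨ y) ∨ z)
    record IsDirectSum (I₁ I₂ : Pred A 0ℓ) : Set where
      field
        mod1 : ∀ x y x₁ x₂ → I₁ x₁ → I₂ x₂ → (x₁ ∨ x₂) ≤ (x ∨ c) →
               meet∨ (x ∨ x₁) (x ∨ x₂) y ≃ meet ((x ∨ y) ∨ x₁) ((x ∨ y) ∨ x₂)
        mod2₁ : ∀ x y x₁ x₂ → I₁ x₁ → I₂ x₂ → x ≤ (x₁ ∨ x₂) →
               meet∨ (x ∨ x₁) (c ∨ x₁) y ≃ meet ((x ∨ y) ∨ x₁) ((c ∨ y) ∨ x₁)
        mod2₂ : ∀ x y x₁ x₂ → I₁ x₁ → I₂ x₂ → x ≤ (x₁ ∨ x₂) →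
               meet∨ (x ∨ x₂) (c ∨ x₂) y ≃ meet ((x ∨ y) ∨ x₂) ((c ∨ y) ∨ x₂)
        abs₁ : ∀ x₁ y₁ z₂ → I₁ x₁ → I₁ y₁ → I₂ z₂ →
               meet x₁ (y₁ ∨ z₂) ≃ meet x₁ (y₁ ∨ c)
        abs₂ : ∀ x₂ y₂ z₁ → I₂ x₂ → I₂ y₂ → I₁ z₁ →
               meet x₂ (y₂ ∨ z₁) ≃ meet x₂ (y₂ ∨ c)
        exi  : ∀ x₁ x₂ → I₁ x₁ → I₂ x₂ → Σ[ x ∈ A ] φ x₁ x₂ x
        onto : ∀ x → Σ[ x₁ ∈ A ] (I₁ x₁ × Σ[ x₂ ∈ A ] (I₂ x₂ × φ x₁ x₂ x))

    module _ {I₁ I₂ : Pred A 0ℓ} (d : IsDirectSum I₁ I₂) where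
      open IsDirectSum d

      -- projections (the components are unique, so taking the witness of (onto) is the map π_j)
      π₁ : A → A
      π₁ x = proj₁ (onto x)

      π₂ : A → A
      π₂ x = proj₁ (proj₂ (proj₂ (onto x)))

      ker-π₁ : Rel A 0ℓ
      ker-π₁ a b = π₁ a ≡ π₁ b

      ker-π₂ : Rel A 0ℓ
      ker-π₂ a b = π₂ a ≡ π₂ b

    I[_] : Rel A 0ℓ → Pred A 0ℓ
    I[ θ ] a = θ a c

-- Complementary factor congruences identify A with A/δ × A/θ, with the order
-- taken coordinatewise; I_θ and I_δ are then the two axes through c, and φ_c(x₁, x₂, x)
-- says that x has the δ-class of x₁ and the θ-class of x₂. Every axiom of I_θ ⊕_c I_δ
-- thereby becomes a statement about classes modulo δ and modulo θ separately.
-- Conversely, in I₁ ⊕_c I₂ the axioms force components to be unique and x ↦ ⟨π₁ x, π₂ x⟩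
-- to be an injective join-homomorphism onto I₁ × I₂, so the kernels of π₂, π₁ are
-- complementary factor congruences. Uniqueness of components makes the constructions
-- mutually inverse: the components produced by θ, δ are the π's, and a lies in I₁ exactly
-- when ⟨a, c⟩ are its components.
module Submission where

open import Defs
open import Algebra.Core using (Op₂)
open import Relation.Binary.Core using (Rel; _⇔_)
open import Relation.Unary using (Pred; _≐_)
open import Level using (0ℓ)

open import Algebra.Bundles using (CommutativeSemigroup)
open import Algebra.Structures using (IsCommutativeBand)
import Algebra.Lattice.Structures as LatticeStructures
import Algebra.Properties.CommutativeSemigroup as CommutativeSemigroupProperties
open import Data.Product using (Σ; Σ-syntax; _×_; _,_; proj₁; proj₂; map₁; map₂)
open import Function.Bundles using (Equivalence; mk⇔)
import Function.Properties.Equivalence as ⇔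
open import Relation.Binary.Bundles using (Poset; Preorder)
open import Relation.Binary.PropositionalEquality
import Relation.Binary.Reasoning.PartialOrder as PartialOrderReasoning
import Relation.Binary.Reasoning.Preorder as PreorderReasoning
open import Relation.Binary.Structures using (IsEquivalence)

module JoinSemilatticeTheory {A : Set} {_∨_ : Op₂ A} (isJoinSL : IsJoinSL A _∨_) where
  open SL _∨_
  open LatticeStructures.IsJoinSemilattice (_≡_ {A = A}) isJoinSL
    using (assoc; comm; idem)

  private
    variable
      a b d m m′ u v w x y z a′ b′ : A

  ∨-commutativeSemigroup : CommutativeSemigroup 0ℓ 0ℓ
  ∨-commutativeSemigroup = record
    { isCommutativeSemigroup = IsCommutativeBand.isCommutativeSemigroup isJoinSL }

  open CommutativeSemigroupProperties ∨-commutativeSemigroup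
    using (interchange; xy∙z≈xz∙y; x∙yz≈y∙xz)

  ∨-distribʳ : ∀ a b y → (a ∨ b) ∨ y ≡ (a ∨ y) ∨ (b ∨ y)
  ∨-distribʳ a b y = begin
    (a ∨ b) ∨ y        ≡⟨ cong ((a ∨ b) ∨_) (idem y) ⟨
    (a ∨ b) ∨ (y ∨ y)  ≡⟨ interchange a b y y ⟩
    (a ∨ y) ∨ (b ∨ y)  ∎
    where open ≡-Reasoning

  ≤-reflexive : a ≡ b → a ≤ b
  ≤-reflexive {a} refl = idem a

  ≤-refl : a ≤ a
  ≤-refl = ≤-reflexive refl

  ≤-trans : a ≤ b → b ≤ d → a ≤ d
  ≤-trans {a} {b} {d} a≤b b≤d = begin
    a ∨ d        ≡⟨ cong (a ∨_) b≤d ⟨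
    a ∨ (b ∨ d)  ≡⟨ assoc a b d ⟨
    (a ∨ b) ∨ d  ≡⟨ cong (_∨ d) a≤b ⟩
    b ∨ d        ≡⟨ b≤d ⟩
    d            ∎
    where open ≡-Reasoning

  ≤-antisym : a ≤ b → b ≤ a → a ≡ b
  ≤-antisym {a} {b} a≤b b≤a = trans (sym b≤a) (trans (comm b a) a≤b)

  x≤x∨y : ∀ x y → x ≤ x ∨ y
  x≤x∨y x y = trans (sym (assoc x x y)) (cong (_∨ y) (idem x))

  y≤x∨y : ∀ x y → y ≤ x ∨ y
  y≤x∨y x y = subst (y ≤_) (comm y x) (x≤x∨y y x)

  ∨-least : a ≤ d → b ≤ d → a ∨ b ≤ d
  ∨-least {a} {d} {b} a≤d b≤d = trans (assoc a b d) (trans (cong (a ∨_) b≤d) a≤d)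

  ∨-monoʳ : a ≤ b → x ∨ a ≤ x ∨ b
  ∨-monoʳ {a} {b} {x} a≤b =
    ∨-least (x≤x∨y x b) (≤-trans a≤b (y≤x∨y x b))

  ∨-monoˡ : a ≤ b → a ∨ x ≤ b ∨ x
  ∨-monoˡ {a} {b} {x} a≤b =
    ∨-least (≤-trans a≤b (x≤x∨y b x)) (y≤x∨y b x)

  ≤-poset : Poset 0ℓ 0ℓ 0ℓ
  ≤-poset = record
    { Carrier = A ; _≈_ = _≡_ ; _≤_ = _≤_
    ; isPartialOrder = record
      { isPreorder = record
        { isEquivalence = isEquivalence ; reflexive = ≤-reflexive ; trans = ≤-trans }
      ; antisym = ≤-antisym } }

  module ≤-Reasoning = PartialOrderReasoning ≤-poset

  IsMeet-greatest : IsMeet a b m → w ≤ a → w ≤ b → w ≤ m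
  IsMeet-greatest (_ , _ , greatest) = greatest _

  IsMeet-unique : IsMeet a b m → IsMeet a b m′ → m ≡ m′
  IsMeet-unique M@(m≤a , m≤b , _) M′@(m′≤a , m′≤b , _) =
    ≤-antisym (IsMeet-greatest M′ m≤a m≤b) (IsMeet-greatest M m′≤a m′≤b)

  IsMeet-comm : IsMeet a b m → IsMeet b a m
  IsMeet-comm (m≤a , m≤b , greatest) = m≤b , m≤a , λ w w≤b w≤a → greatest w w≤a w≤b

  ≤⇒IsMeet : a ≤ b → IsMeet a b a
  ≤⇒IsMeet a≤b = ≤-refl , a≤b , λ _ w≤a _ → w≤a

  ≃-sym : {P Q : Pred A 0ℓ} → P ≃ Q → Q ≃ P
  ≃-sym P≃Q v = ⇔.sym (P≃Q v)

  ≃-trans : {P Q R : Pred A 0ℓ} → P ≃ Q → Q ≃ R → P ≃ R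
  ≃-trans P≃Q Q≃R v = ⇔.trans (P≃Q v) (Q≃R v)

  meet-comm : meet a b ≃ meet b a
  meet-comm _ = mk⇔ IsMeet-comm IsMeet-comm

  meet∨-comm : meet∨ a b y ≃ meet∨ b a y
  meet∨-comm _ = mk⇔ (map₂ (map₁ IsMeet-comm)) (map₂ (map₁ IsMeet-comm))

  meet∨-≃ : IsMeet a b m → IsMeet a′ b′ (m ∨ y) → meet∨ a b y ≃ meet a′ b′
  meet∨-≃ {y = y} M M′ _ = mk⇔
    (λ { (m , N , refl) → subst (λ t → IsMeet _ _ (t ∨ y)) (IsMeet-unique M N) M′ })
    (λ N → _ , M , IsMeet-unique M′ N)

  meet∨-≃⇒IsMeet : meet∨ a b y ≃ meet a′ b′ → IsMeet a b m → IsMeet a′ b′ (m ∨ y)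
  meet∨-≃⇒IsMeet e M = Equivalence.to (e _) (_ , M , refl)

  meet-≃⇒≤ : meet a b ≃ meet a b′ → a ≤ b → a ≤ b′
  meet-≃⇒≤ e a≤b = proj₁ (proj₂ (Equivalence.to (e _) (≤⇒IsMeet a≤b)))

  meet-≃-lowerBounds : (∀ {w} → w ≤ a → w ≤ b → w ≤ b′) → (∀ {w} → w ≤ a → w ≤ b′ → w ≤ b) →
                       meet a b ≃ meet a b′
  meet-≃-lowerBounds to from _ = mk⇔
    (λ (m≤a , m≤b , greatest) → m≤a , to m≤a m≤b , λ w w≤a w≤b′ → greatest w w≤a (from w≤a w≤b′))
    (λ (m≤a , m≤b′ , greatest) → m≤a , from m≤a m≤b′ , λ w w≤a w≤b → greatest w w≤a (to w≤a w≤b))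

  ker-isCongruence : {B : Set} (_∙_ : Op₂ B) (f : A → B) →
                     (∀ a b → f (a ∨ b) ≡ f a ∙ f b) → IsCongruence (λ a b → f a ≡ f b)
  ker-isCongruence _∙_ f f-hom = record
    { isEquivalence = record { refl = refl ; sym = sym ; trans = trans }
    ; ∨-compat = λ {a} {b} {a′} {b′} fa≡fa′ fb≡fb′ → begin
        f (a ∨ b)     ≡⟨ f-hom a b ⟩
        f a ∙ f b     ≡⟨ cong₂ _∙_ fa≡fa′ fb≡fb′ ⟩
        f a′ ∙ f b′   ≡⟨ f-hom a′ b′ ⟨
        f (a′ ∨ b′)   ∎ }
    where open ≡-Reasoning

  module QuotientOrder {ρ : Rel A 0ℓ} (ρ-cong : IsCongruence ρ) where
    open IsCongruence ρ-cong public using (∨-compat)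
    open IsEquivalence (IsCongruence.isEquivalence ρ-cong) public
      renaming (refl to ρ-refl; sym to ρ-sym; trans to ρ-trans; reflexive to ρ-reflexive)

    infix 4 _≼_
    _≼_ : Rel A 0ℓ
    a ≼ b = ρ (a ∨ b) b

    ∨-absorbˡ : ρ a b → ρ (a ∨ b) b
    ∨-absorbˡ {a} {b} a≈b = ρ-trans (∨-compat a≈b ρ-refl) (ρ-reflexive (idem b))

    ≼-reflexive : ρ a b → a ≼ b
    ≼-reflexive = ∨-absorbˡ

    ≤⇒≼ : a ≤ b → a ≼ b
    ≤⇒≼ a≤b = ρ-reflexive a≤b

    ∨-absorbʳ : ρ a b → ρ (b ∨ a) b
    ∨-absorbʳ {a} {b} a≈b = ρ-trans (∨-compat ρ-refl a≈b) (ρ-reflexive (idem b))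

    ≼-trans : a ≼ b → b ≼ d → a ≼ d
    ≼-trans {a} {b} {d} a≼b b≼d =
      ρ-trans (∨-compat (ρ-refl {a}) (ρ-sym b≼d))
        (ρ-trans (ρ-reflexive (sym (assoc a b d))) (ρ-trans (∨-compat a≼b ρ-refl) b≼d))

    ≼-∨-monoʳ : a ≼ b → a ∨ y ≼ b ∨ y
    ≼-∨-monoʳ {a} {b} {y} a≼b =
      ρ-trans (ρ-reflexive (sym (∨-distribʳ a b y))) (∨-compat a≼b ρ-refl)

    ∨-mono-≼ : ρ b d → a ≤ x ∨ d → x ∨ a ≼ x ∨ b
    ∨-mono-≼ {b} {d} {a} {x} b≈d a≤x∨d =
      ≼-trans (≤⇒≼ (∨-least (x≤x∨y x d) a≤x∨d)) (≼-reflexive (∨-compat ρ-refl (ρ-sym b≈d)))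

    ≼-preorder : Preorder 0ℓ 0ℓ 0ℓ
    ≼-preorder = record
      { Carrier = A ; _≈_ = ρ ; _≲_ = _≼_
      ; isPreorder = record
        { isEquivalence = IsCongruence.isEquivalence ρ-cong
        ; reflexive = ≼-reflexive ; trans = ≼-trans } }

    module ≼-Reasoning = PreorderReasoning ≼-preorder

  module DirectSum (c : A) where

    private
      variable
        x₁ x₂ y₁ y₂ z₁ z₂ : A
        I₁ I₂ : Pred A 0ℓ

    φ-swap : φ c x₁ x₂ x → φ c x₂ x₁ x
    φ-swap {x₁} {x₂} (dist , p₁ , p₂ , join) = IsMeet-comm dist , p₂ , p₁ , trans (comm x₂ x₁) join

    φ-≤-components : φ c x₁ x₂ x → x ≤ x₁ ∨ x₂
    φ-≤-components {x = x} (_ , _ , _ , join) = subst (x ≤_) (sym join) (x≤x∨y x c)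

    φ-component₁-≤ : φ c x₁ x₂ x → x₁ ≤ x ∨ c
    φ-component₁-≤ {x₁} {x₂} (_ , _ , _ , join) = subst (x₁ ≤_) join (x≤x∨y x₁ x₂)

    φ-refl₁ : ∀ a → φ c a c a
    φ-refl₁ a =
        subst (λ t → IsMeet t (a ∨ c) a) (sym (idem a)) (≤⇒IsMeet (x≤x∨y a c))
      , subst (λ t → IsMeet t (c ∨ a) a) (sym (idem a)) (≤⇒IsMeet (y≤x∨y c a))
      , subst (λ t → IsMeet (a ∨ c) t c) (sym (idem c)) (IsMeet-comm (≤⇒IsMeet (y≤x∨y a c)))
      , refl

    φ-refl₁⁻¹ : φ c x₁ c x → x ≡ x₁
    φ-refl₁⁻¹ {x₁} {x} X@(dist , p₁ , _ , _) = ≤-antisym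
      (IsMeet-greatest p₁ (x≤x∨y x x₁) (subst (x ≤_) (comm x₁ c) (φ-≤-components X)))
      (IsMeet-greatest dist (y≤x∨y x x₁) (φ-component₁-≤ X))

    -- Facts about the first summand only; those about the second are obtained by
    -- applying them to  swap d  below.
    module _ (d : IsDirectSum c I₁ I₂) where
      open IsDirectSum d

      π₁∈I₁ : ∀ x → I₁ (π₁ c d x)
      π₁∈I₁ x = proj₁ (proj₂ (onto x))

      π₂∈I₂ : ∀ x → I₂ (π₂ c d x)
      π₂∈I₂ x = proj₁ (proj₂ (proj₂ (proj₂ (onto x))))

      φ-π : ∀ x → φ c (π₁ c d x) (π₂ c d x) x
      φ-π x = proj₂ (proj₂ (proj₂ (proj₂ (onto x))))

      π₁-c : π₁ c d c ≡ c
      π₁-c = ≤-antisym π₁c≤c c≤π₁c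
        where
          π₁c≤c : π₁ c d c ≤ c
          π₁c≤c = subst (π₁ c d c ≤_) (idem c) (φ-component₁-≤ (φ-π c))
          c≤π₁c : c ≤ π₁ c d c
          c≤π₁c = IsMeet-unique (≤⇒IsMeet ≤-refl) (proj₁ (proj₂ (φ-π c)))

      c∈I₁ : I₁ c
      c∈I₁ = subst I₁ π₁-c (π₁∈I₁ c)

      c≤∨ : I₁ y₁ → I₂ z₂ → c ≤ y₁ ∨ z₂
      c≤∨ {y₁} {z₂} y₁∈ z₂∈ = meet-≃⇒≤ (≃-sym (abs₁ c y₁ z₂ c∈I₁ y₁∈ z₂∈)) (y≤x∨y y₁ c)

      abs₁-≤ : I₁ x₁ → I₁ y₁ → I₂ z₂ → x₁ ≤ y₁ ∨ z₂ → x₁ ≤ y₁ ∨ c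
      abs₁-≤ {x₁} {y₁} {z₂} x₁∈ y₁∈ z₂∈ = meet-≃⇒≤ (abs₁ x₁ y₁ z₂ x₁∈ y₁∈ z₂∈)

      mod1-IsMeet : I₁ x₁ → I₂ x₂ → x₁ ∨ x₂ ≤ x ∨ c → IsMeet (x ∨ x₁) (x ∨ x₂) x →
                    ∀ y → IsMeet ((x ∨ y) ∨ x₁) ((x ∨ y) ∨ x₂) (x ∨ y)
      mod1-IsMeet x₁∈ x₂∈ x₁∨x₂≤x∨c dist y =
        meet∨-≃⇒IsMeet (mod1 _ y _ _ x₁∈ x₂∈ x₁∨x₂≤x∨c) dist

      φ-dist-∨ : I₁ x₁ → I₂ x₂ → φ c x₁ x₂ x →
                 ∀ y → IsMeet ((x ∨ y) ∨ x₁) ((x ∨ y) ∨ x₂) (x ∨ y)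
      φ-dist-∨ x₁∈ x₂∈ (dist , _ , _ , join) = mod1-IsMeet x₁∈ x₂∈ (≤-reflexive join) dist

      φ-p₁-∨ : I₁ x₁ → I₂ x₂ → φ c x₁ x₂ x →
               ∀ y → IsMeet ((x ∨ y) ∨ x₁) ((c ∨ y) ∨ x₁) (x₁ ∨ y)
      φ-p₁-∨ x₁∈ x₂∈ X@(_ , p₁ , _ , _) y =
        meet∨-≃⇒IsMeet (mod2₁ _ y _ _ x₁∈ x₂∈ (φ-≤-components X)) p₁

      component₁-≤ : I₁ x₁ → I₂ x₂ → I₁ z₁ → I₂ z₂ → φ c x₁ x₂ x → φ c z₁ z₂ x → z₁ ≤ x₁
      component₁-≤ {x₁} {x₂} {z₁} {z₂} {x} x₁∈ x₂∈ z₁∈ z₂∈ (_ , p₁ , _ , join) Z =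
        IsMeet-greatest p₁ z₁≤x∨x₁ (subst (z₁ ≤_) (comm x₁ c) z₁≤x₁∨c)
        where
          open ≤-Reasoning
          z₁≤x∨c : z₁ ≤ x ∨ c
          z₁≤x∨c = φ-component₁-≤ Z
          z₁≤x₁∨c : z₁ ≤ x₁ ∨ c
          z₁≤x₁∨c = abs₁-≤ z₁∈ x₁∈ x₂∈ (subst (z₁ ≤_) (sym join) z₁≤x∨c)
          z₁≤x∨x₁ : z₁ ≤ x ∨ x₁
          z₁≤x∨x₁ = IsMeet-greatest (φ-dist-∨ z₁∈ z₂∈ Z x₁) (y≤x∨y (x ∨ x₁) z₁) (begin
            z₁             ≤⟨ z₁≤x∨c ⟩
            x ∨ c          ≤⟨ ∨-monoʳ (c≤∨ x₁∈ z₂∈) ⟩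
            x ∨ (x₁ ∨ z₂)  ≡⟨ assoc x x₁ z₂ ⟨
            (x ∨ x₁) ∨ z₂  ∎)

      component₁-unique : I₁ x₁ → I₂ x₂ → I₁ z₁ → I₂ z₂ → φ c x₁ x₂ x → φ c z₁ z₂ x → z₁ ≡ x₁
      component₁-unique x₁∈ x₂∈ z₁∈ z₂∈ X Z =
        ≤-antisym (component₁-≤ x₁∈ x₂∈ z₁∈ z₂∈ X Z) (component₁-≤ z₁∈ z₂∈ x₁∈ x₂∈ Z X)

      ≤-∨-component₁ : I₁ x₁ → I₂ x₂ → φ c x₁ x₂ x → φ c x₁ x₂ z → z ≤ x ∨ x₁
      ≤-∨-component₁ {x₁} {x₂} {x} {z} x₁∈ x₂∈ (_ , _ , _ , joinX) Z@(_ , _ , _ , joinZ) =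
        subst (z ≤_) (comm x₁ x) (IsMeet-greatest (φ-p₁-∨ x₁∈ x₂∈ Z x) z≤[z∨x]∨x₁ z≤[c∨x]∨x₁)
        where
          open ≤-Reasoning
          z≤[z∨x]∨x₁ : z ≤ (z ∨ x) ∨ x₁
          z≤[z∨x]∨x₁ = ≤-trans (x≤x∨y z x) (x≤x∨y (z ∨ x) x₁)
          z≤[c∨x]∨x₁ : z ≤ (c ∨ x) ∨ x₁
          z≤[c∨x]∨x₁ = begin
            z             ≤⟨ x≤x∨y z c ⟩
            z ∨ c         ≡⟨ joinZ ⟨
            x₁ ∨ x₂       ≡⟨ joinX ⟩
            x ∨ c         ≡⟨ comm x c ⟩
            c ∨ x         ≤⟨ x≤x∨y (c ∨ x) x₁ ⟩
            (c ∨ x) ∨ x₁  ∎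

      ∨-dist-step : I₁ x₁ → I₂ x₂ → I₁ y₁ → φ c x₁ x₂ x → φ c y₁ y₂ y →
                    w ≤ (x ∨ y) ∨ (x₁ ∨ y₁) → w ≤ (x ∨ y) ∨ y₁
      ∨-dist-step {x₁} {x₂} {y₁} {x} {y₂} {y} {w} x₁∈ x₂∈ y₁∈ X@(_ , _ , _ , joinX) Y w≤ =
        IsMeet-greatest (mod1-IsMeet x₁∈ x₂∈ x₁∨x₂≤s∨c (φ-dist-∨ x₁∈ x₂∈ X y) y₁)
          (begin
            w              ≤⟨ w≤ ⟩
            s ∨ (x₁ ∨ y₁)  ≡⟨ cong (s ∨_) (comm x₁ y₁) ⟩
            s ∨ (y₁ ∨ x₁)  ≡⟨ assoc s y₁ x₁ ⟨
            (s ∨ y₁) ∨ x₁  ∎)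
          (begin
            w              ≤⟨ w≤ ⟩
            s ∨ (x₁ ∨ y₁)  ≤⟨ ∨-least (x≤x∨y s c) (∨-least x₁≤s∨c y₁≤s∨c) ⟩
            s ∨ c          ≤⟨ ∨-monoʳ (c≤∨ y₁∈ x₂∈) ⟩
            s ∨ (y₁ ∨ x₂)  ≡⟨ assoc s y₁ x₂ ⟨
            (s ∨ y₁) ∨ x₂  ∎)
        where
          open ≤-Reasoning
          s = x ∨ y
          x₁∨x₂≤s∨c : x₁ ∨ x₂ ≤ s ∨ c
          x₁∨x₂≤s∨c = ≤-trans (≤-reflexive joinX) (∨-monoˡ (x≤x∨y x y))
          x₁≤s∨c : x₁ ≤ s ∨ c
          x₁≤s∨c = ≤-trans (φ-component₁-≤ X) (∨-monoˡ (x≤x∨y x y))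
          y₁≤s∨c : y₁ ≤ s ∨ c
          y₁≤s∨c = ≤-trans (φ-component₁-≤ Y) (∨-monoˡ (y≤x∨y x y))

      φ-∨-p₁ : I₁ x₁ → I₂ x₂ → I₁ y₁ → I₂ y₂ → φ c x₁ x₂ x → φ c y₁ y₂ y →
               IsMeet ((x ∨ y) ∨ (x₁ ∨ y₁)) (c ∨ (x₁ ∨ y₁)) (x₁ ∨ y₁)
      φ-∨-p₁ {x₁} {x₂} {y₁} {y₂} {x} {y} x₁∈ x₂∈ y₁∈ y₂∈ X Y =
        y≤x∨y (x ∨ y) (x₁ ∨ y₁) , y≤x∨y c (x₁ ∨ y₁) , greatest
        where
          greatest : ∀ w → w ≤ (x ∨ y) ∨ (x₁ ∨ y₁) → w ≤ c ∨ (x₁ ∨ y₁) → w ≤ x₁ ∨ y₁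
          greatest w w≤s∨x₁y₁ w≤c∨x₁y₁ = subst (w ≤_) (comm y₁ x₁)
            (IsMeet-greatest (φ-p₁-∨ y₁∈ y₂∈ Y x₁)
              (subst (w ≤_) (trans (x∙yz≈y∙xz x₁ y y₁) (sym (assoc y x₁ y₁))) w≤x₁∨yy₁)
              (subst (w ≤_) (sym (assoc c x₁ y₁)) w≤c∨x₁y₁))
            where
              open ≤-Reasoning
              w≤x₁∨yy₁ : w ≤ x₁ ∨ (y ∨ y₁)
              w≤x₁∨yy₁ = IsMeet-greatest (φ-p₁-∨ x₁∈ x₂∈ X (y ∨ y₁))
                (begin
                  w                        ≤⟨ w≤s∨x₁y₁ ⟩
                  (x ∨ y) ∨ (x₁ ∨ y₁)      ≡⟨ cong ((x ∨ y) ∨_) (comm x₁ y₁) ⟩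
                  (x ∨ y) ∨ (y₁ ∨ x₁)      ≡⟨ assoc (x ∨ y) y₁ x₁ ⟨
                  ((x ∨ y) ∨ y₁) ∨ x₁      ≡⟨ cong (_∨ x₁) (assoc x y y₁) ⟩
                  (x ∨ (y ∨ y₁)) ∨ x₁      ∎)
                (begin
                  w                        ≤⟨ w≤c∨x₁y₁ ⟩
                  c ∨ (x₁ ∨ y₁)            ≡⟨ cong (c ∨_) (comm x₁ y₁) ⟩
                  c ∨ (y₁ ∨ x₁)            ≡⟨ assoc c y₁ x₁ ⟨
                  (c ∨ y₁) ∨ x₁            ≤⟨ ∨-monoˡ (∨-monoʳ (y≤x∨y y y₁)) ⟩
                  (c ∨ (y ∨ y₁)) ∨ x₁      ∎)

    swap : IsDirectSum c I₁ I₂ → IsDirectSum c I₂ I₁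
    swap d = record
      { mod1 = λ x y x₂ x₁ x₂∈ x₁∈ x₂∨x₁≤x∨c →
          ≃-trans meet∨-comm
            (≃-trans (mod1 x y x₁ x₂ x₁∈ x₂∈ (subst (_≤ x ∨ c) (comm x₂ x₁) x₂∨x₁≤x∨c)) meet-comm)
      ; mod2₁ = λ x y x₂ x₁ x₂∈ x₁∈ x≤x₂∨x₁ → mod2₂ x y x₁ x₂ x₁∈ x₂∈ (subst (x ≤_) (comm x₂ x₁) x≤x₂∨x₁)
      ; mod2₂ = λ x y x₂ x₁ x₂∈ x₁∈ x≤x₂∨x₁ → mod2₁ x y x₁ x₂ x₁∈ x₂∈ (subst (x ≤_) (comm x₂ x₁) x≤x₂∨x₁)
      ; abs₁ = abs₂
      ; abs₂ = abs₁
      ; exi = λ x₂ x₁ x₂∈ x₁∈ → map₂ φ-swap (exi x₁ x₂ x₁∈ x₂∈)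
      ; onto = λ x → π₂ c d x , π₂∈I₂ d x , π₁ c d x , π₁∈I₁ d x , φ-swap (φ-π d x)
      }
      where open IsDirectSum d

    module _ (d : IsDirectSum c I₁ I₂) where
      open IsDirectSum d

      π-unique : I₁ x₁ → I₂ x₂ → φ c x₁ x₂ x → π₁ c d x ≡ x₁ × π₂ c d x ≡ x₂
      π-unique {x = x} x₁∈ x₂∈ X =
          component₁-unique d x₁∈ x₂∈ (π₁∈I₁ d x) (π₂∈I₂ d x) X (φ-π d x)
        , component₁-unique (swap d) x₂∈ x₁∈ (π₂∈I₂ d x) (π₁∈I₁ d x) (φ-swap X) (φ-swap (φ-π d x))

      φ-injective : I₁ x₁ → I₂ x₂ → φ c x₁ x₂ x → φ c x₁ x₂ z → z ≡ x
      φ-injective {x₁} {x₂} x₁∈ x₂∈ X Z = ≤-antisym (≤-represented X Z) (≤-represented Z X)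
        where
          ≤-represented : ∀ {u v} → φ c x₁ x₂ u → φ c x₁ x₂ v → v ≤ u
          ≤-represented X@(dist , _) Z = IsMeet-greatest dist
            (≤-∨-component₁ d x₁∈ x₂∈ X Z) (≤-∨-component₁ (swap d) x₂∈ x₁∈ (φ-swap X) (φ-swap Z))

      φ-∨ : I₁ x₁ → I₂ x₂ → I₁ y₁ → I₂ y₂ → φ c x₁ x₂ x → φ c y₁ y₂ y →
            φ c (x₁ ∨ y₁) (x₂ ∨ y₂) (x ∨ y)
      φ-∨ {x₁} {x₂} {y₁} {y₂} {x} {y} x₁∈ x₂∈ y₁∈ y₂∈ X@(_ , _ , _ , joinX) Y@(_ , _ , _ , joinY) =
          dist
        , φ-∨-p₁ d x₁∈ x₂∈ y₁∈ y₂∈ X Y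
        , φ-∨-p₁ (swap d) x₂∈ x₁∈ y₂∈ y₁∈ (φ-swap X) (φ-swap Y)
        , join
        where
          dist : IsMeet ((x ∨ y) ∨ (x₁ ∨ y₁)) ((x ∨ y) ∨ (x₂ ∨ y₂)) (x ∨ y)
          dist = x≤x∨y (x ∨ y) (x₁ ∨ y₁) , x≤x∨y (x ∨ y) (x₂ ∨ y₂) , λ w w≤₁ w≤₂ →
            IsMeet-greatest (subst (λ s → IsMeet (s ∨ y₁) (s ∨ y₂) s) (comm y x) (φ-dist-∨ d y₁∈ y₂∈ Y x))
              (∨-dist-step d x₁∈ x₂∈ y₁∈ X Y w≤₁)
              (∨-dist-step (swap d) x₂∈ x₁∈ y₂∈ (φ-swap X) (φ-swap Y) w≤₂)
          join : (x₁ ∨ y₁) ∨ (x₂ ∨ y₂) ≡ (x ∨ y) ∨ c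
          join = begin
            (x₁ ∨ y₁) ∨ (x₂ ∨ y₂)  ≡⟨ interchange x₁ y₁ x₂ y₂ ⟩
            (x₁ ∨ x₂) ∨ (y₁ ∨ y₂)  ≡⟨ cong₂ _∨_ joinX joinY ⟩
            (x ∨ c) ∨ (y ∨ c)      ≡⟨ ∨-distribʳ x y c ⟨
            (x ∨ y) ∨ c            ∎
            where open ≡-Reasoning

      I-ker-π₂≐I₁ : I[_] c (ker-π₂ c d) ≐ I₁
      I-ker-π₂≐I₁ = ker⊆I₁ , I₁⊆ker
        where
          ker⊆I₁ : ∀ {a} → π₂ c d a ≡ π₂ c d c → I₁ a
          ker⊆I₁ {a} π₂a≡π₂c = subst I₁ (sym (φ-refl₁⁻¹ represents-a)) (π₁∈I₁ d a)
            where
              represents-a : φ c (π₁ c d a) c a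
              represents-a = subst (λ t → φ c (π₁ c d a) t a) (trans π₂a≡π₂c (π₁-c (swap d))) (φ-π d a)
          I₁⊆ker : ∀ {a} → I₁ a → π₂ c d a ≡ π₂ c d c
          I₁⊆ker {a} a∈ = trans (proj₂ (π-unique a∈ (c∈I₁ (swap d)) (φ-refl₁ a))) (sym (π₁-c (swap d)))

      module _ (I₁-sub : IsSubSL I₁) (I₂-sub : IsSubSL I₂) where

        π-∨ : ∀ a b → π₁ c d (a ∨ b) ≡ π₁ c d a ∨ π₁ c d b × π₂ c d (a ∨ b) ≡ π₂ c d a ∨ π₂ c d b
        π-∨ a b = π-unique (I₁-sub (π₁∈I₁ d a) (π₁∈I₁ d b)) (I₂-sub (π₂∈I₂ d a) (π₂∈I₂ d b))
          (φ-∨ (π₁∈I₁ d a) (π₂∈I₂ d a) (π₁∈I₁ d b) (π₂∈I₂ d b) (φ-π d a) (φ-π d b))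

        ker-isComplFactorCong : IsComplFactorCong (ker-π₂ c d) (ker-π₁ c d)
        ker-isComplFactorCong = record
          { θ-cong = ker-isCongruence _∨_ (π₂ c d) (λ a b → proj₂ (π-∨ a b))
          ; δ-cong = ker-isCongruence _∨_ (π₁ c d) (λ a b → proj₁ (π-∨ a b))
          ; inj = λ {a} {b} π₁a≡π₁b π₂a≡π₂b → φ-injective (π₁∈I₁ d a) (π₂∈I₂ d a)
              (subst₂ (λ t₁ t₂ → φ c t₁ t₂ b) (sym π₁a≡π₁b) (sym π₂a≡π₂b) (φ-π d b)) (φ-π d a)
          ; surj = λ a b → let (x , X) = exi (π₁ c d a) (π₂ c d b) (π₁∈I₁ d a) (π₂∈I₂ d b) in
              x , π-unique (π₁∈I₁ d a) (π₂∈I₂ d b) X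
          }

  private
    variable
      θ δ ρ : Rel A 0ℓ

  IsComplFactorCong-swap : IsComplFactorCong θ δ → IsComplFactorCong δ θ
  IsComplFactorCong-swap fc = record
    { θ-cong = δ-cong
    ; δ-cong = θ-cong
    ; inj = λ a≈θb a≈δb → inj a≈δb a≈θb
    ; surj = λ a b → proj₁ (surj b a) , proj₂ (proj₂ (surj b a)) , proj₁ (proj₂ (surj b a))
    }
    where open IsComplFactorCong fc

  I-isSubSL : (c : A) → IsCongruence ρ → IsSubSL (I[_] c ρ)
  I-isSubSL c ρ-cong a≈c b≈c = ρ-trans (∨-compat a≈c b≈c) (ρ-reflexive (idem c))
    where open QuotientOrder ρ-cong

  module FactorCongruences (c : A) {θ δ : Rel A 0ℓ} (fc : IsComplFactorCong θ δ) where
    open IsComplFactorCong fc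
    open DirectSum c
    private
      module Θ = QuotientOrder θ-cong
      module Δ = QuotientOrder δ-cong
      variable
        x₁ x₂ : A
    open Θ using () renaming (_≼_ to _≼θ_)
    open Δ using () renaming (_≼_ to _≼δ_)

    IsMeet-intro : δ m u → θ m v → u ≼δ v → v ≼θ u → IsMeet u v m
    IsMeet-intro m≈δu m≈θv u≼δv v≼θu =
        inj (Δ.≼-reflexive m≈δu) (Θ.≼-trans (Θ.≼-reflexive m≈θv) v≼θu)
      , inj (Δ.≼-trans (Δ.≼-reflexive m≈δu) u≼δv) (Θ.≼-reflexive m≈θv)
      , λ w w≤u w≤v → inj (Δ.≼-trans (Δ.≤⇒≼ w≤u) (Δ.≼-reflexive (Δ.ρ-sym m≈δu)))
                          (Θ.≼-trans (Θ.≤⇒≼ w≤v) (Θ.≼-reflexive (Θ.ρ-sym m≈θv)))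

    IsMeet-of-≈ : δ u m → θ v m → m ≤ u → m ≤ v → IsMeet u v m
    IsMeet-of-≈ u≈δm v≈θm m≤u m≤v = m≤u , m≤v , λ w w≤u w≤v →
      inj (Δ.≼-trans (Δ.≤⇒≼ w≤u) (Δ.≼-reflexive u≈δm)) (Θ.≼-trans (Θ.≤⇒≼ w≤v) (Θ.≼-reflexive v≈θm))

    meet∨-≃-meet-∨ : u ≼δ v → v ≼θ u → ∀ y → meet∨ u v y ≃ meet (u ∨ y) (v ∨ y)
    meet∨-≃-meet-∨ {u} {v} u≼δv v≼θu y =
      let (m , m≈δu , m≈θv) = surj u v in
      meet∨-≃ (IsMeet-intro m≈δu m≈θv u≼δv v≼θu)
              (IsMeet-intro (Δ.∨-compat m≈δu Δ.ρ-refl) (Θ.∨-compat m≈θv Θ.ρ-refl)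
                            (Δ.≼-∨-monoʳ u≼δv) (Θ.≼-∨-monoʳ v≼θu))

    mod1 : ∀ x y x₁ x₂ → θ x₁ c → δ x₂ c → x₁ ∨ x₂ ≤ x ∨ c →
           meet∨ (x ∨ x₁) (x ∨ x₂) y ≃ meet ((x ∨ y) ∨ x₁) ((x ∨ y) ∨ x₂)
    mod1 x y x₁ x₂ x₁≈θc x₂≈δc x₁∨x₂≤x∨c =
      subst₂ (λ a b → meet∨ (x ∨ x₁) (x ∨ x₂) y ≃ meet a b) (xy∙z≈xz∙y x x₁ y) (xy∙z≈xz∙y x x₂ y)
        (meet∨-≃-meet-∨ (Δ.∨-mono-≼ x₂≈δc (≤-trans (x≤x∨y x₁ x₂) x₁∨x₂≤x∨c))
                        (Θ.∨-mono-≼ x₁≈θc (≤-trans (y≤x∨y x₁ x₂) x₁∨x₂≤x∨c)) y)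

    mod2 : ∀ x y x₁ x₂ → θ x₁ c → δ x₂ c → x ≤ x₁ ∨ x₂ →
           meet∨ (x ∨ x₁) (c ∨ x₁) y ≃ meet ((x ∨ y) ∨ x₁) ((c ∨ y) ∨ x₁)
    mod2 x y x₁ x₂ x₁≈θc x₂≈δc x≤x₁∨x₂ =
      subst₂ (λ a b → meet∨ (x ∨ x₁) (c ∨ x₁) y ≃ meet a b) (xy∙z≈xz∙y x x₁ y) (xy∙z≈xz∙y c x₁ y)
        (meet∨-≃-meet-∨ x∨x₁≼δc∨x₁ c∨x₁≼θx∨x₁ y)
      where
        x∨x₁≼δc∨x₁ : x ∨ x₁ ≼δ c ∨ x₁
        x∨x₁≼δc∨x₁ = begin
          x ∨ x₁   ≲⟨ Δ.≤⇒≼ (∨-least x≤x₁∨x₂ (x≤x∨y x₁ x₂)) ⟩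
          x₁ ∨ x₂  ≈⟨ Δ.∨-compat Δ.ρ-refl x₂≈δc ⟩
          x₁ ∨ c   ≡⟨ comm x₁ c ⟩
          c ∨ x₁   ∎
          where open Δ.≼-Reasoning
        c∨x₁≼θx∨x₁ : c ∨ x₁ ≼θ x ∨ x₁
        c∨x₁≼θx∨x₁ = begin
          c ∨ x₁   ≈⟨ Θ.∨-absorbˡ (Θ.ρ-sym x₁≈θc) ⟩
          x₁       ≲⟨ Θ.≤⇒≼ (y≤x∨y x x₁) ⟩
          x ∨ x₁   ∎
          where open Θ.≼-Reasoning

    abs : ∀ x₁ y₁ z₂ → θ x₁ c → θ y₁ c → δ z₂ c → meet x₁ (y₁ ∨ z₂) ≃ meet x₁ (y₁ ∨ c)
    abs x₁ y₁ z₂ x₁≈θc y₁≈θc z₂≈δc = meet-≃-lowerBounds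
      (λ {w} w≤x₁ w≤y₁∨z₂ → inj
        (let open Δ.≼-Reasoning in begin
          w        ≲⟨ Δ.≤⇒≼ w≤y₁∨z₂ ⟩
          y₁ ∨ z₂  ≈⟨ Δ.∨-compat Δ.ρ-refl z₂≈δc ⟩
          y₁ ∨ c   ∎)
        (let open Θ.≼-Reasoning in begin
          w        ≲⟨ Θ.≤⇒≼ w≤x₁ ⟩
          x₁       ≈⟨ x₁≈θc ⟩
          c        ≲⟨ Θ.≤⇒≼ (y≤x∨y y₁ c) ⟩
          y₁ ∨ c   ∎))
      (λ {w} w≤x₁ w≤y₁∨c → inj
        (let open Δ.≼-Reasoning in begin
          w        ≲⟨ Δ.≤⇒≼ w≤y₁∨c ⟩
          y₁ ∨ c   ≈⟨ Δ.∨-compat Δ.ρ-refl z₂≈δc ⟨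
          y₁ ∨ z₂  ∎)
        (let open Θ.≼-Reasoning in begin
          w        ≲⟨ Θ.≤⇒≼ w≤x₁ ⟩
          x₁       ≈⟨ x₁≈θc ⟩
          c        ≈⟨ y₁≈θc ⟨
          y₁       ≲⟨ Θ.≤⇒≼ (x≤x∨y y₁ z₂) ⟩
          y₁ ∨ z₂  ∎))

    φ-intro : θ x₁ c → δ x₂ c → δ x x₁ → θ x x₂ → φ c x₁ x₂ x
    φ-intro {x₁} {x₂} {x} x₁≈θc x₂≈δc x≈δx₁ x≈θx₂ =
        IsMeet-of-≈ (Δ.∨-absorbʳ (Δ.ρ-sym x≈δx₁)) (Θ.∨-absorbʳ (Θ.ρ-sym x≈θx₂))
                    (x≤x∨y x x₁) (x≤x∨y x x₂)
      , IsMeet-of-≈ (Δ.∨-absorbˡ x≈δx₁) (Θ.∨-absorbˡ (Θ.ρ-sym x₁≈θc))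
                    (y≤x∨y x x₁) (y≤x∨y c x₁)
      , IsMeet-comm (IsMeet-of-≈ (Δ.∨-absorbˡ (Δ.ρ-sym x₂≈δc)) (Θ.∨-absorbˡ x≈θx₂)
                                 (y≤x∨y c x₂) (y≤x∨y x x₂))
      , inj (Δ.∨-compat (Δ.ρ-sym x≈δx₁) x₂≈δc)
            (Θ.ρ-trans (Θ.∨-compat x₁≈θc (Θ.ρ-sym x≈θx₂)) (Θ.ρ-reflexive (comm c x)))

    φ-exists : θ x₁ c → δ x₂ c → Σ[ x ∈ A ] φ c x₁ x₂ x
    φ-exists {x₁} {x₂} x₁≈θc x₂≈δc =
      let (x , x≈δx₁ , x≈θx₂) = surj x₁ x₂ in x , φ-intro x₁≈θc x₂≈δc x≈δx₁ x≈θx₂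

    -- In A ≅ A/δ × A/θ the components of x = ⟨x/δ, x/θ⟩ are ⟨x/δ, c/θ⟩ and ⟨c/δ, x/θ⟩.
    φ-onto : ∀ x → Σ[ x₁ ∈ A ] (θ x₁ c × Σ[ x₂ ∈ A ] (δ x₂ c × φ c x₁ x₂ x))
    φ-onto x =
      let (x₁ , x₁≈δx , x₁≈θc) = surj x c
          (x₂ , x₂≈δc , x₂≈θx) = surj c x
      in x₁ , x₁≈θc , x₂ , x₂≈δc , φ-intro x₁≈θc x₂≈δc (Δ.ρ-sym x₁≈δx) (Θ.ρ-sym x₂≈θx)

    π₁-δ : (d : IsDirectSum c (I[_] c θ) (I[_] c δ)) → ∀ x → δ (π₁ c d x) x
    π₁-δ d x =
      let (x₁ , x₁≈θc , x₂ , x₂≈δc , X) = φ-onto x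
      in subst (λ t → δ t x) (sym (proj₁ (π-unique d x₁≈θc x₂≈δc X))) (proj₁ (proj₂ (surj x c)))

  I-isDirectSum : (c : A) → IsComplFactorCong θ δ → IsDirectSum c (I[_] c θ) (I[_] c δ)
  I-isDirectSum c fc = record
    { mod1 = F.mod1
    ; mod2₁ = F.mod2
    ; mod2₂ = λ x y x₁ x₂ x₁∈ x₂∈ x≤x₁∨x₂ → F′.mod2 x y x₂ x₁ x₂∈ x₁∈ (subst (x ≤_) (comm x₁ x₂) x≤x₁∨x₂)
    ; abs₁ = λ x₁ y₁ z₂ → F.abs x₁ y₁ z₂
    ; abs₂ = λ x₂ y₂ z₁ → F′.abs x₂ y₂ z₁
    ; exi = λ x₁ x₂ → F.φ-exists
    ; onto = F.φ-onto
    }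
    where
      module F = FactorCongruences c fc
      module F′ = FactorCongruences c (IsComplFactorCong-swap fc)

  ker-π₂⇔θ : (c : A) (fc : IsComplFactorCong θ δ) (d : IsDirectSum c (I[_] c θ) (I[_] c δ)) →
             ker-π₂ c d ⇔ θ
  ker-π₂⇔θ {θ} {δ} c fc d =
      (λ {a} {b} π₂a≡π₂b → θ-trans (θ-sym (π₂-θ a)) (subst (λ t → θ t b) (sym π₂a≡π₂b) (π₂-θ b)))
    , (λ {a} {b} a≈θb → inj (δ-trans (π₂∈I₂ d a) (δ-sym (π₂∈I₂ d b)))
                             (θ-trans (π₂-θ a) (θ-trans a≈θb (θ-sym (π₂-θ b)))))
    where
      open IsComplFactorCong fc
      open DirectSum c
      open QuotientOrder θ-cong using () renaming (ρ-sym to θ-sym; ρ-trans to θ-trans)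
      open QuotientOrder δ-cong using () renaming (ρ-sym to δ-sym; ρ-trans to δ-trans)
      π₂-θ : ∀ x → θ (π₂ c d x) x
      π₂-θ = FactorCongruences.π₁-δ c (IsComplFactorCong-swap fc) (swap d)

theorem1 : (A : Set) (_∨_ : Op₂ A) → IsJoinSL A _∨_ → (c : A) →
    let open SL _∨_ in
    -- 𝖨 is well-defined
    (∀ (θ δ : Rel A 0ℓ) → IsComplFactorCong θ δ →
       IsSubSL (I[_] c θ) × IsSubSL (I[_] c δ) × IsDirectSum c (I[_] c θ) (I[_] c δ))
    -- 𝖪 is well-defined
    × (∀ (I₁ I₂ : Pred A 0ℓ) → IsSubSL I₁ → IsSubSL I₂ → (d : IsDirectSum c I₁ I₂) →
       IsComplFactorCong (ker-π₂ c d) (ker-π₁ c d))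
    -- 𝖪 ∘ 𝖨 = id
    × (∀ (θ δ : Rel A 0ℓ) → IsComplFactorCong θ δ →
       (d : IsDirectSum c (I[_] c θ) (I[_] c δ)) →
       (ker-π₂ c d ⇔ θ) × (ker-π₁ c d ⇔ δ))
    -- 𝖨 ∘ 𝖪 = id
    × (∀ (I₁ I₂ : Pred A 0ℓ) → IsSubSL I₁ → IsSubSL I₂ → (d : IsDirectSum c I₁ I₂) →
       (I[_] c (ker-π₂ c d) ≐ I₁) × (I[_] c (ker-π₁ c d) ≐ I₂))
theorem1 A _∨_ isJoinSL c =
    (λ θ δ fc → I-isSubSL c (θ-cong fc) , I-isSubSL c (δ-cong fc) , I-isDirectSum c fc)
  , (λ I₁ I₂ I₁-sub I₂-sub d → ker-isComplFactorCong d I₁-sub I₂-sub)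
  , (λ θ δ fc d → ker-π₂⇔θ c fc d , ker-π₂⇔θ c (IsComplFactorCong-swap fc) (swap d))
  , (λ I₁ I₂ _ _ d → I-ker-π₂≐I₁ d , I-ker-π₂≐I₁ (swap d))
  where
    open JoinSemilatticeTheory isJoinSL
    open DirectSum c
    open SL.IsComplFactorCong
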